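{- Let $q$ be an odd prime power and consider $PG(2,q)$ with the quadratic form $Q(X)=x_0^2-x_1^2+\alpha x_2^2$, $\alpha\in\mathbb{F}_q^{*}$. For each of the submatrices $\mathbf{A}_{11},\mathbf{A}_{12},\mathbf{A}_{21},\mathbf{A}_{22}$ of the incidence matrix (defined in the context), its $2$-rank does not depend on the choice of the nonzero element $\alpha$.
   Context: Points of $PG(2,q)$ are $1$-dimensional subspaces of $\mathbb{F}_q^3$; the associated bilinear form is $\langle X,Y\rangle=x_0y_0-x_1y_1+\alpha x_2y_2$. A point $P$ is isotropic if $Q(P)=0$ and anisotropic otherwise; $P^\perp=\{R:\langle P,R\rangle=0\}$ is the line corresponding to $P$. The incidence matrix $\mathbf{A}$ has rows indexed by lines $P^\perp$ and columns by points $R$, with entry $1$ iff $\langle P,R\rangle=0$. The blocks are: $\mathbf{A}_{11}$ (rows $P^\perp$ with $P$ anisotropic, columns anisotropic points), $\mathbf{A}_{12}$ (rows $P^\perp$ with $P$ anisotropic, columns isotropic points), $\mathbf{A}_{21}$ (rows $P^\perp$ with $P$ isotropic, columns anisotropic points), $\mathbf{A}_{22}$ (rows $P^\perp$ with $P$ isotropic, columns isotropic points). The $2$-rank is the rank over $\mathbb{F}_2$. -}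

module Defs where

open import Level using (0ℓ)
open import Data.Nat using (ℕ; _≤_)
open import Data.Bool using (Bool; true; false; _∧_; _xor_)
open import Data.List using (List; []; _∷_; length; map; zipWith; foldr)
open import Data.List.Relation.Unary.All using (All)
open import Data.List.Membership.Propositional using (_∈_)
open import Data.Product using (Σ; _×_; _,_; ∃)
open import Data.Sum using (_⊎_)
open import Relation.Nullary using (¬_; yes; no)
open import Relation.Binary.PropositionalEquality using (_≡_)
open import Relation.Binary.Definitions using (DecidableEquality)
open import Algebra.Structures using (IsCommutativeRing)

record FiniteField : Set₁ where
  infixl 6 _+_
  infixl 7 _*_
  field
    Carrier  : Set
    _+_ _*_  : Carrier → Carrier → Carrier
    -_       : Carrier → Carrier
    0# 1#    : Carrier
    isCommutativeRing : IsCommutativeRing _≡_ _+_ _*_ -_ 0# 1#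
    0≢1      : ¬ (0# ≡ 1#)
    inverse  : ∀ x → ¬ (x ≡ 0#) → Σ Carrier (λ y → x * y ≡ 1#)
    _≟_      : DecidableEquality Carrier
    elements : List Carrier
    complete : ∀ x → x ∈ elements

Matrix : Set → Set → Set
Matrix R C = R → C → Bool

lincomb : {C : Set} → List Bool → List (C → Bool) → C → Bool
lincomb cs vs c = foldr _xor_ false (zipWith (λ a v → a ∧ v c) cs vs)

LinIndep : {C : Set} → List (C → Bool) → Set
LinIndep vs = ∀ (cs : List Bool) → length cs ≡ length vs →
              (∀ c → lincomb cs vs c ≡ false) → All (_≡ false) cs

Has2Rank : {R C : Set} → Matrix R C → ℕ → Set
Has2Rank {R} M r =
  Σ (List R) (λ rs → length rs ≡ r × LinIndep (map M rs)) ×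
  (∀ (rs : List R) → LinIndep (map M rs) → length rs ≤ r)

module Plane (F : FiniteField) where
  open FiniteField F

  Vec3 : Set
  Vec3 = Carrier × Carrier × Carrier

  -- Normalized representative of a 1-dimensional subspace:
  -- first nonzero coordinate equals 1.
  Normalized : Vec3 → Set
  Normalized (x₀ , x₁ , x₂) =
    (x₀ ≡ 1#) ⊎ ((x₀ ≡ 0#) × (x₁ ≡ 1#)) ⊎ ((x₀ ≡ 0#) × (x₁ ≡ 0#) × (x₂ ≡ 1#))

  Point : Set
  Point = Σ Vec3 Normalized

  form : Carrier → Vec3 → Vec3 → Carrier
  form α (x₀ , x₁ , x₂) (y₀ , y₁ , y₂) = x₀ * y₀ + - (x₁ * y₁) + α * (x₂ * y₂)

  Q : Carrier → Vec3 → Carrier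
  Q α (x₀ , x₁ , x₂) = x₀ * x₀ + - (x₁ * x₁) + α * (x₂ * x₂)

  data Kind : Set where
    anisotropic isotropic : Kind

  HasKind : Carrier → Kind → Point → Set
  HasKind α anisotropic (x , _) = ¬ (Q α x ≡ 0#)
  HasKind α isotropic   (x , _) = Q α x ≡ 0#

  PointOf : Carrier → Kind → Set
  PointOf α k = Σ Point (HasKind α k)

  incidence : Carrier → Point → Point → Bool
  incidence α (p , _) (r , _) with form α p r ≟ 0#
  ... | yes _ = true
  ... | no  _ = false

  -- Block A_{ij}: rows P^⊥ with P of kind i, columns points R of kind j.
  -- A₁₁ = block α anisotropic anisotropic, A₁₂ = block α anisotropic isotropic,
  -- A₂₁ = block α isotropic anisotropic,   A₂₂ = block α isotropic isotropic.
  block : (α : Carrier) → (i j : Kind) → Matrix (PointOf α i) (PointOf α j)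
  block α i j (P , _) (R , _) = incidence α P R

{-# OPTIONS --safe #-}
-- For nonzero α, β put c = β / α. The linear map
--   (x₀ , x₁ , x₂) ↦ ((c+1)x₀ + (c−1)x₁ , (c−1)x₀ + (c+1)x₁ , 2x₂)
-- scales x₀ + x₁ by 2c, x₀ − x₁ by 2 and x₂ by 2, hence ⟨gX, gY⟩_β = 4c ⟨X, Y⟩_α. As q is odd it is
-- invertible, so it permutes the points of PG(2,q), preserving orthogonality and (an)isotropy: each
-- block for β is the corresponding block for α with rows and columns relabelled, which does not
-- change the 2-rank. That a 2-rank exists at all uses that F₂-independent rows are pairwise
-- distinct, so their number is bounded and a maximal family is found by exhaustive search.
module Submission where

open import Defs
open import Algebra.Bundles using (CommutativeRing)
open import Level using (0ℓ)
open import Data.Product using (Σ; _×_; _,_)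
open import Data.Nat using (ℕ)
open import Relation.Nullary using (¬_)
open import Relation.Binary.PropositionalEquality using (_≡_)

module F₂Rank where
  open import Data.Bool using (Bool; true; false; _∧_; _xor_)
  open import Data.Bool.Properties using (xor-same) renaming (_≟_ to _≟ᵇ_)
  open import Data.Empty using (⊥-elim)
  open import Data.Fin as Fin using (Fin; zero; suc)
  import Data.Fin.Properties as FinP
  open import Data.List using (List; []; _∷_; length; map; replicate; lookup)
  open import Data.List.Properties using (length-map; length-replicate)
  open import Data.List.Membership.Propositional using (_∈_)
  open import Data.List.Membership.Propositional.Properties using (∈-lookup)
  open import Data.List.Relation.Unary.All as All using (All; []; _∷_)
  open import Data.List.Relation.Unary.AllPairs using ([]; _∷_)
  open import Data.List.Relation.Unary.Any as Any using (Any; here; there)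
  open import Data.List.Relation.Unary.Any.Properties using (lookup-index)
  open import Data.List.Relation.Unary.Unique.Propositional using (Unique)
  open import Data.Nat using (zero; suc; _≤_; s≤s)
  import Data.Nat.Properties as ℕ
  open import Data.Product using (∃)
  open import Function using (_∘_)
  open import Relation.Binary.PropositionalEquality
  open import Relation.Nullary using (Dec; yes; no)
  open import Relation.Nullary.Decidable using (_→-dec_)

  private
    variable
      R C R′ C′ : Set

  lincomb-relabel : (M : Matrix R C) (M′ : Matrix R′ C′) (f : R → R′) {c : C} {c′ : C′} →
                    (∀ r → M′ (f r) c′ ≡ M r c) →
                    ∀ cs rs → lincomb cs (map M′ (map f rs)) c′ ≡ lincomb cs (map M rs) c
  lincomb-relabel M M′ f eq []       rs       = refl
  lincomb-relabel M M′ f eq (_ ∷ _)  []       = refl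
  lincomb-relabel M M′ f eq (a ∷ cs) (r ∷ rs) =
    cong₂ (λ x y → (a ∧ x) xor y) (eq r) (lincomb-relabel M M′ f eq cs rs)

  LinIndep-relabel : (M : Matrix R C) (M′ : Matrix R′ C′) (f : R → R′) (h : C → C′) →
                     (∀ r c → M′ (f r) (h c) ≡ M r c) →
                     ∀ rs → LinIndep (map M rs) → LinIndep (map M′ (map f rs))
  LinIndep-relabel M M′ f h eq rs indep cs len vanish = indep cs len′ λ c →
    trans (sym (lincomb-relabel M M′ f (λ r → eq r c) cs rs)) (vanish (h c))
    where
    len′ : length cs ≡ length (map M rs)
    len′ = trans len (trans (length-map M′ (map f rs))
                     (trans (length-map f rs) (sym (length-map M rs))))

  Has2Rank-transport : (M : Matrix R C) (M′ : Matrix R′ C′)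
                       (f : R → R′) (h : C → C′) (g : R′ → R) (k : C′ → C) →
                       (∀ r c → M′ (f r) (h c) ≡ M r c) → (∀ r′ c′ → M (g r′) (k c′) ≡ M′ r′ c′) →
                       ∀ {n} → Has2Rank M n → Has2Rank M′ n
  Has2Rank-transport M M′ f h g k eq eq′ ((rs , len , indep) , maximal) =
    (map f rs , trans (length-map f rs) len , LinIndep-relabel M M′ f h eq rs indep) ,
    λ rs′ indep′ → subst (_≤ _) (length-map g rs′)
                     (maximal (map g rs′) (LinIndep-relabel M′ M g k eq′ rs′ indep′))

  xor-false : ∀ b → b xor false ≡ b
  xor-false true  = refl
  xor-false false = refl

  lincomb-zeros : ∀ k (vs : List (C → Bool)) c → lincomb (replicate k false) vs c ≡ false
  lincomb-zeros zero    vs       c = refl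
  lincomb-zeros (suc k) []       c = refl
  lincomb-zeros (suc k) (v ∷ vs) c = lincomb-zeros k vs c

  indicator : {A : Set} {a : A} {xs : List A} → a ∈ xs → List Bool
  indicator {xs = _ ∷ xs} (here _) = true ∷ replicate (length xs) false
  indicator (there p)              = false ∷ indicator p

  length-indicator : {A : Set} {a : A} {xs : List A} (p : a ∈ xs) → length (indicator p) ≡ length xs
  length-indicator {xs = _ ∷ xs} (here _) = cong suc (length-replicate (length xs))
  length-indicator (there p)              = cong suc (length-indicator p)

  lincomb-indicator : (M : Matrix R C) {a : R} {rs : List R} (p : a ∈ rs) →
                      ∀ c → lincomb (indicator p) (map M rs) c ≡ M a c
  lincomb-indicator M {rs = r ∷ rs} (here refl) c =
    trans (cong ((true ∧ M r c) xor_) (lincomb-zeros (length rs) (map M rs) c)) (xor-false (M r c))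
  lincomb-indicator M (there p) c = lincomb-indicator M p c

  LinIndep-tail : (v : C → Bool) (vs : List (C → Bool)) → LinIndep (v ∷ vs) → LinIndep vs
  LinIndep-tail v vs indep cs len vanish = All.tail (indep (false ∷ cs) (cong suc len) vanish)

  LinIndep⇒head∉tail : (M : Matrix R C) (a : R) (rs : List R) → LinIndep (map M (a ∷ rs)) → ¬ a ∈ rs
  LinIndep⇒head∉tail M a rs indep a∈rs
    with indep (true ∷ indicator a∈rs)
               (cong suc (trans (length-indicator a∈rs) (sym (length-map M rs))))
               (λ c → trans (cong ((true ∧ M a c) xor_) (lincomb-indicator M a∈rs c)) (xor-same (M a c)))
  ... | () ∷ _

  LinIndep⇒Unique : (M : Matrix R C) (rs : List R) → LinIndep (map M rs) → Unique rs
  LinIndep⇒Unique M []       indep = []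
  LinIndep⇒Unique M (a ∷ rs) indep =
    All.tabulate (λ x∈rs a≡x → LinIndep⇒head∉tail M a rs indep (subst (_∈ rs) (sym a≡x) x∈rs)) ∷
    LinIndep⇒Unique M rs (LinIndep-tail (M a) (map M rs) indep)

  Unique⇒lookup-distinct : {A : Set} (xs : List A) → Unique xs →
                           ∀ i j → i Fin.< j → lookup xs i ≢ lookup xs j
  Unique⇒lookup-distinct (x ∷ xs) (x∉xs ∷ _)  zero    (suc j) _         = All.lookup x∉xs (∈-lookup j)
  Unique⇒lookup-distinct (x ∷ xs) (_ ∷ unique) (suc i) (suc j) (s≤s i<j) =
    Unique⇒lookup-distinct xs unique i j i<j

  Unique⇒length≤ : ∀ {n} (xs : List (Fin n)) → Unique xs → length xs ≤ n
  Unique⇒length≤ {n} xs unique with n ℕ.<? length xs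
  ... | no  n≮len = ℕ.≮⇒≥ n≮len
  ... | yes n<len with FinP.pigeonhole n<len (lookup xs)
  ... | i , j , i<j , same = ⊥-elim (Unique⇒lookup-distinct xs unique i j i<j same)

  ∀-ofLength? : ∀ k (P : List Bool → Set) → (∀ bs → Dec (P bs)) →
                Dec (∀ bs → length bs ≡ k → P bs)
  ∀-ofLength? zero P P? with P? []
  ... | yes p  = yes λ { [] refl → p }
  ... | no ¬p  = no λ all → ¬p (all [] refl)
  ∀-ofLength? (suc k) P P?
    with ∀-ofLength? k (P ∘ (true ∷_)) (P? ∘ (true ∷_)) | ∀-ofLength? k (P ∘ (false ∷_)) (P? ∘ (false ∷_))
  ... | yes pt | yes pf = yes λ { (true  ∷ bs) len → pt bs (ℕ.suc-injective len)
                                ; (false ∷ bs) len → pf bs (ℕ.suc-injective len) }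
  ... | no ¬pt | _      = no λ all → ¬pt λ bs len → all (true  ∷ bs) (cong suc len)
  ... | yes _  | no ¬pf = no λ all → ¬pf λ bs len → all (false ∷ bs) (cong suc len)

  ∃-ofLength? : ∀ {n} k (P : List (Fin n) → Set) → (∀ xs → Dec (P xs)) →
                Dec (∃ λ xs → length xs ≡ k × P xs)
  ∃-ofLength? zero P P? with P? []
  ... | yes p = yes ([] , refl , p)
  ... | no ¬p = no λ { ([] , _ , p) → ¬p p }
  ∃-ofLength? (suc k) P P? with FinP.any? (λ i → ∃-ofLength? k (P ∘ (i ∷_)) (P? ∘ (i ∷_)))
  ... | yes (i , xs , len , p) = yes (i ∷ xs , cong suc len , p)
  ... | no ¬p = no λ { ([] , () , _) ; (i ∷ xs , len , p) → ¬p (i , xs , ℕ.suc-injective len , p) }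

  LinIndep? : ∀ {m} (vs : List (Fin m → Bool)) → Dec (LinIndep vs)
  LinIndep? vs = ∀-ofLength? (length vs) _ λ cs →
    FinP.all? (λ c → lincomb cs vs c ≟ᵇ false) →-dec All.all? (_≟ᵇ false) cs

  module _ {n m : ℕ} (M : Matrix (Fin n) (Fin m)) where

    LinIndep⇒length≤ : ∀ rs → LinIndep (map M rs) → length rs ≤ n
    LinIndep⇒length≤ rs indep = Unique⇒length≤ rs (LinIndep⇒Unique M rs indep)

    has2Rank-≤ : ∀ k → (∀ rs → LinIndep (map M rs) → length rs ≤ k) → ∃ (Has2Rank M)
    has2Rank-≤ zero bound = zero , ([] , refl , λ { [] refl _ → [] }) , bound
    has2Rank-≤ (suc k) bound with ∃-ofLength? (suc k) (LinIndep ∘ map M) (LinIndep? ∘ map M)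
    ... | yes witness = suc k , witness , bound
    ... | no ¬witness = has2Rank-≤ k λ rs indep →
          ℕ.≤-pred (ℕ.≤∧≢⇒< (bound rs indep) λ len → ¬witness (rs , len , indep))

    has2Rank-Fin : ∃ (Has2Rank M)
    has2Rank-Fin = has2Rank-≤ n LinIndep⇒length≤

  has2Rank-coveredBy : (M : Matrix R C) (rows : List R) (cols : List C) →
             (∀ r → Any (λ r′ → ∀ c → M r′ c ≡ M r c) rows) →
             (∀ c → Any (λ c′ → ∀ r → M r c′ ≡ M r c) cols) →
             ∃ (Has2Rank M)
  has2Rank-coveredBy {R} {C} M rows cols rows-cover cols-cover
    with has2Rank-Fin (λ i j → M (lookup rows i) (lookup cols j))
  ... | r , rank = r , Has2Rank-transport _ M (lookup rows) (lookup cols) rowIndex colIndex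
                         (λ _ _ → refl) sameEntry rank
    where
    rowIndex : R → Fin (length rows)
    rowIndex r = Any.index (rows-cover r)
    colIndex : C → Fin (length cols)
    colIndex c = Any.index (cols-cover c)
    sameEntry : ∀ r c → M (lookup rows (rowIndex r)) (lookup cols (colIndex c)) ≡ M r c
    sameEntry r c = trans (lookup-index (cols-cover c) _) (lookup-index (rows-cover r) c)

-- The ring solver decides equalities by computing on coefficients, which needs a concrete
-- coefficient ring; ℤ maps into every commutative ring.
module IntegerCoefficients (R : CommutativeRing 0ℓ 0ℓ) where
  open import Algebra.Solver.Ring.AlmostCommutativeRing
    using (AlmostCommutativeRing; fromCommutativeRing; _-Raw-AlmostCommutative⟶_)
  open import Data.Integer as ℤ using (ℤ; +_; +[1+_]; -[1+_]; _⊖_; _◃_; sign; ∣_∣)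
  import Data.Integer.Properties as ℤ
  open import Data.Maybe using (Maybe; just; nothing)
  open import Data.Nat as ℕ using (zero; suc)
  import Data.Nat.Properties as ℕ
  open import Data.Sign as Sign using (Sign)
  open import Relation.Binary.PropositionalEquality as ≡ using (cong)
  open import Relation.Nullary using (yes; no)

  open CommutativeRing R
  open import Algebra.Properties.Ring ring
    using (-‿distribˡ-*; -‿distribʳ-*; -‿involutive; -0#≈0#; -‿+-comm)
  open import Algebra.Properties.CommutativeSemigroup +-commutativeSemigroup using (interchange)
  open import Algebra.Properties.Semiring.Mult.TCOptimised semiring using (×-homo-+; ×1-homo-*)
    renaming (_×_ to _×′_)
  open import Relation.Binary.Reasoning.Setoid setoid

  signed : Sign → Carrier → Carrier
  signed Sign.+ x = x
  signed Sign.- x = - x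

  ⟦_⟧ : ℤ → Carrier
  ⟦ i ⟧ = signed (sign i) (∣ i ∣ ×′ 1#)

  signed-cong : ∀ s {x y} → x ≈ y → signed s x ≈ signed s y
  signed-cong Sign.+ x≈y = x≈y
  signed-cong Sign.- x≈y = -‿cong x≈y

  signed-* : ∀ s t x y → signed (s Sign.* t) (x * y) ≈ signed s x * signed t y
  signed-* Sign.+ Sign.+ x y = refl
  signed-* Sign.+ Sign.- x y = -‿distribʳ-* x y
  signed-* Sign.- Sign.+ x y = -‿distribˡ-* x y
  signed-* Sign.- Sign.- x y = begin
    x * y             ≈⟨ -‿involutive (x * y) ⟨
    - - (x * y)       ≈⟨ -‿cong (-‿distribʳ-* x y) ⟩
    - (x * - y)       ≈⟨ -‿distribˡ-* x (- y) ⟩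
    - x * - y         ∎

  ⟦◃⟧ : ∀ s n → ⟦ s ◃ n ⟧ ≈ signed s (n ×′ 1#)
  ⟦◃⟧ Sign.+ zero    = refl
  ⟦◃⟧ Sign.- zero    = sym -0#≈0#
  ⟦◃⟧ Sign.+ (suc n) = refl
  ⟦◃⟧ Sign.- (suc n) = refl

  ⟦⊖⟧ : ∀ m n → ⟦ m ⊖ n ⟧ ≈ m ×′ 1# - n ×′ 1#
  ⟦⊖⟧ zero    zero    = sym (trans (+-identityˡ _) -0#≈0#)
  ⟦⊖⟧ zero    (suc n) = sym (+-identityˡ _)
  ⟦⊖⟧ (suc m) zero    = sym (trans (+-congˡ -0#≈0#) (+-identityʳ _))
  ⟦⊖⟧ (suc m) (suc n) = begin
    ⟦ suc m ⊖ suc n ⟧                 ≡⟨ cong ⟦_⟧ (ℤ.[1+m]⊖[1+n]≡m⊖n m n) ⟩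
    ⟦ m ⊖ n ⟧                         ≈⟨ ⟦⊖⟧ m n ⟩
    m ×′ 1# - n ×′ 1#                   ≈⟨ +-identityˡ _ ⟨
    0# + (m ×′ 1# - n ×′ 1#)            ≈⟨ +-congʳ (-‿inverseʳ 1#) ⟨
    (1# - 1#) + (m ×′ 1# - n ×′ 1#)     ≈⟨ interchange 1# (- 1#) (m ×′ 1#) (- (n ×′ 1#)) ⟩
    (1# + m ×′ 1#) + (- 1# - n ×′ 1#)   ≈⟨ +-cong (×-homo-+ 1# 1 m) (sym (-‿+-comm 1# (n ×′ 1#))) ⟨
    suc m ×′ 1# - (1# + n ×′ 1#)        ≈⟨ +-congˡ (-‿cong (×-homo-+ 1# 1 n)) ⟨
    suc m ×′ 1# - suc n ×′ 1#           ∎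

  ⟦+⟧ : ∀ i j → ⟦ i ℤ.+ j ⟧ ≈ ⟦ i ⟧ + ⟦ j ⟧
  ⟦+⟧ (+ m)    (+ n)    = ×-homo-+ 1# m n
  ⟦+⟧ (+ m)    -[1+ n ] = ⟦⊖⟧ m (suc n)
  ⟦+⟧ -[1+ m ] (+ n)    = trans (⟦⊖⟧ n (suc m)) (+-comm _ _)
  ⟦+⟧ -[1+ m ] -[1+ n ] = begin
    - (suc (suc (m ℕ.+ n)) ×′ 1#)      ≡⟨ cong (λ k → - (suc k ×′ 1#)) (ℕ.+-suc m n) ⟨
    - ((suc m ℕ.+ suc n) ×′ 1#)        ≈⟨ -‿cong (×-homo-+ 1# (suc m) (suc n)) ⟩
    - (suc m ×′ 1# + suc n ×′ 1#)       ≈⟨ -‿+-comm _ _ ⟨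
    - (suc m ×′ 1#) - suc n ×′ 1#       ∎

  ⟦*⟧ : ∀ i j → ⟦ i ℤ.* j ⟧ ≈ ⟦ i ⟧ * ⟦ j ⟧
  ⟦*⟧ i j = begin
    ⟦ s ◃ (∣ i ∣ ℕ.* ∣ j ∣) ⟧              ≈⟨ ⟦◃⟧ s (∣ i ∣ ℕ.* ∣ j ∣) ⟩
    signed s ((∣ i ∣ ℕ.* ∣ j ∣) ×′ 1#)    ≈⟨ signed-cong s (×1-homo-* ∣ i ∣ ∣ j ∣) ⟩
    signed s (∣ i ∣ ×′ 1# * ∣ j ∣ ×′ 1#)  ≈⟨ signed-* (sign i) (sign j) _ _ ⟩
    ⟦ i ⟧ * ⟦ j ⟧                          ∎
    where
    s : Sign
    s = sign i Sign.* sign j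

  ⟦-⟧ : ∀ i → ⟦ ℤ.- i ⟧ ≈ - ⟦ i ⟧
  ⟦-⟧ (+ zero)  = sym -0#≈0#
  ⟦-⟧ +[1+ n ]  = refl
  ⟦-⟧ -[1+ n ]  = sym (-‿involutive _)

  almostCommutativeRing : AlmostCommutativeRing 0ℓ 0ℓ
  almostCommutativeRing = fromCommutativeRing R

  ℤ-homomorphism : ℤ.+-*-rawRing -Raw-AlmostCommutative⟶ almostCommutativeRing
  ℤ-homomorphism = record
    { ⟦_⟧ = ⟦_⟧ ; +-homo = ⟦+⟧ ; *-homo = ⟦*⟧ ; -‿homo = ⟦-⟧ ; 0-homo = refl ; 1-homo = refl }

  ⟦⟧-equal? : ∀ i j → Maybe (⟦ i ⟧ ≈ ⟦ j ⟧)
  ⟦⟧-equal? i j with i ℤ.≟ j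
  ... | yes ≡.refl = just refl
  ... | no  _    = nothing

  open import Algebra.Solver.Ring ℤ.+-*-rawRing almostCommutativeRing ℤ-homomorphism ⟦⟧-equal? public
    using (solve; _:=_; _:+_; _:*_; _:-_; con)

module Field (F : FiniteField) where
  open import Data.Product using (proj₁; proj₂)
  open import Function using (_∘_)
  open import Relation.Binary.PropositionalEquality
  open FiniteField F
  open ≡-Reasoning

  commutativeRing : CommutativeRing 0ℓ 0ℓ
  commutativeRing = record { isCommutativeRing = isCommutativeRing }

  open CommutativeRing commutativeRing using (*-comm; *-assoc; *-identityˡ; zeroʳ)

  *-cancelˡ-≡0 : ∀ {x y} → ¬ x ≡ 0# → x * y ≡ 0# → y ≡ 0#
  *-cancelˡ-≡0 {x} {y} x≢0 xy≡0 with inverse x x≢0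
  ... | x′ , xx′≡1 = begin
    y              ≡⟨ sym (*-identityˡ y) ⟩
    1# * y         ≡⟨ cong (_* y) (trans (sym xx′≡1) (*-comm x x′)) ⟩
    x′ * x * y     ≡⟨ *-assoc x′ x y ⟩
    x′ * (x * y)   ≡⟨ cong (x′ *_) xy≡0 ⟩
    x′ * 0#        ≡⟨ zeroʳ x′ ⟩
    0#             ∎

  1≢0 : ¬ 1# ≡ 0#
  1≢0 = 0≢1 ∘ sym

  ≡0⇒*≡0 : ∀ {x y} → y ≡ 0# → x * y ≡ 0#
  ≡0⇒*≡0 {x} refl = zeroʳ x

  *-≢0 : ∀ {x y} → ¬ x ≡ 0# → ¬ y ≡ 0# → ¬ x * y ≡ 0#
  *-≢0 x≢0 y≢0 = y≢0 ∘ *-cancelˡ-≡0 x≢0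

  inverse-≢0 : ∀ x (x≢0 : ¬ x ≡ 0#) → ¬ proj₁ (inverse x x≢0) ≡ 0#
  inverse-≢0 x x≢0 x′≡0 = 0≢1 (begin
    0#                           ≡⟨ sym (zeroʳ x) ⟩
    x * 0#                       ≡⟨ cong (x *_) (sym x′≡0) ⟩
    x * proj₁ (inverse x x≢0)    ≡⟨ proj₂ (inverse x x≢0) ⟩
    1#                           ∎)

module ProjectivePlane (F : FiniteField) where
  open import Data.Empty using (⊥-elim)
  open import Data.Integer using (+_)
  open import Data.List using (List; mapMaybe; cartesianProduct)
  open import Data.List.Membership.Propositional using (_∈_)
  open import Data.List.Membership.Propositional.Properties using (∈-cartesianProduct⁺)
  open import Data.List.Relation.Unary.Any as Any using (Any)
  open import Data.List.Relation.Unary.Any.Properties using (mapMaybe⁺; map⁺)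
  open import Data.Maybe using (Maybe; just; nothing)
  import Data.Maybe.Relation.Unary.Any as Maybe
  open import Data.Product using (proj₁; proj₂)
  open import Data.Sum using (inj₁; inj₂)
  open import Relation.Binary.PropositionalEquality
  open import Relation.Nullary using (Dec; yes; no)
  open import Relation.Nullary.Decidable using (¬?; _⊎-dec_; _×-dec_)
  open F₂Rank using (has2Rank-coveredBy; Has2Rank-transport)
  open FiniteField F
  open Plane F
  open Field F
  open IntegerCoefficients commutativeRing using (solve; _:=_; _:+_; _:*_; _:-_; con)
  open CommutativeRing commutativeRing using (+-comm; *-comm; *-assoc; *-identityˡ; *-identityʳ)
  open ≡-Reasoning

  IsZeroVec : Vec3 → Set
  IsZeroVec (x₀ , x₁ , x₂) = x₀ ≡ 0# × x₁ ≡ 0# × x₂ ≡ 0#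

  Normalized⇒¬IsZeroVec : ∀ {x} → Normalized x → ¬ IsZeroVec x
  Normalized⇒¬IsZeroVec (inj₁ x₀≡1)                  (x₀≡0 , _)      = 0≢1 (trans (sym x₀≡0) x₀≡1)
  Normalized⇒¬IsZeroVec (inj₂ (inj₁ (_ , x₁≡1)))     (_ , x₁≡0 , _)  = 0≢1 (trans (sym x₁≡0) x₁≡1)
  Normalized⇒¬IsZeroVec (inj₂ (inj₂ (_ , _ , x₂≡1))) (_ , _ , x₂≡0)  = 0≢1 (trans (sym x₂≡0) x₂≡1)

  infixr 7 _·_
  _·_ : Carrier → Vec3 → Vec3
  s · (x₀ , x₁ , x₂) = s * x₀ , s * x₁ , s * x₂

  form-· : ∀ a s t x y → form a (s · x) (t · y) ≡ (s * t) * form a x y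
  form-· a s t (x₀ , x₁ , x₂) (y₀ , y₁ , y₂) = solve 9
    (λ a s t x₀ x₁ x₂ y₀ y₁ y₂ →
       (s :* x₀) :* (t :* y₀) :- (s :* x₁) :* (t :* y₁) :+ a :* ((s :* x₂) :* (t :* y₂))
       := (s :* t) :* (x₀ :* y₀ :- x₁ :* y₁ :+ a :* (x₂ :* y₂)))
    refl a s t x₀ x₁ x₂ y₀ y₁ y₂

  normalize : ∀ x → ¬ IsZeroVec x → Σ Carrier λ s → ¬ s ≡ 0# × Normalized (s · x)
  normalize (x₀ , x₁ , x₂) x≢0 with x₀ ≟ 0# | x₁ ≟ 0# | x₂ ≟ 0#
  ... | no x₀≢0 | _ | _ = let x₀′ , x₀x₀′≡1 = inverse x₀ x₀≢0 in
    x₀′ , inverse-≢0 x₀ x₀≢0 , inj₁ (trans (*-comm x₀′ x₀) x₀x₀′≡1)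
  ... | yes x₀≡0 | no x₁≢0 | _ = let x₁′ , x₁x₁′≡1 = inverse x₁ x₁≢0 in
    x₁′ , inverse-≢0 x₁ x₁≢0 , inj₂ (inj₁ (≡0⇒*≡0 x₀≡0 , trans (*-comm x₁′ x₁) x₁x₁′≡1))
  ... | yes x₀≡0 | yes x₁≡0 | no x₂≢0 = let x₂′ , x₂x₂′≡1 = inverse x₂ x₂≢0 in
    x₂′ , inverse-≢0 x₂ x₂≢0 ,
    inj₂ (inj₂ (≡0⇒*≡0 x₀≡0 , ≡0⇒*≡0 x₁≡0 , trans (*-comm x₂′ x₂) x₂x₂′≡1))
  ... | yes x₀≡0 | yes x₁≡0 | yes x₂≡0 = ⊥-elim (x≢0 (x₀≡0 , x₁≡0 , x₂≡0))

  -- In the coordinates x₀ + x₁ and x₀ − x₁ this is scaling by a + b and a − b.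
  hyperbolic : Carrier → Carrier → Carrier → Vec3 → Vec3
  hyperbolic a b d (x₀ , x₁ , x₂) = a * x₀ + b * x₁ , b * x₀ + a * x₁ , d * x₂

  module _ {α β a b d : Carrier} (βd²≡kα : β * (d * d) ≡ (a * a + - (b * b)) * α) where

    form-hyperbolic : ∀ x y → form β (hyperbolic a b d x) (hyperbolic a b d y)
                              ≡ (a * a + - (b * b)) * form α x y
    form-hyperbolic (x₀ , x₁ , x₂) (y₀ , y₁ , y₂) = begin
      form β (hyperbolic a b d (x₀ , x₁ , x₂)) (hyperbolic a b d (y₀ , y₁ , y₂))
        ≡⟨ solve 10 (λ a b d β x₀ x₁ x₂ y₀ y₁ y₂ →
             (a :* x₀ :+ b :* x₁) :* (a :* y₀ :+ b :* y₁) :- (b :* x₀ :+ a :* x₁) :* (b :* y₀ :+ a :* y₁)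
               :+ β :* ((d :* x₂) :* (d :* y₂))
             := (a :* a :- b :* b) :* (x₀ :* y₀ :- x₁ :* y₁) :+ β :* (d :* d) :* (x₂ :* y₂))
             refl a b d β x₀ x₁ x₂ y₀ y₁ y₂ ⟩
      k * (x₀ * y₀ + - (x₁ * y₁)) + β * (d * d) * (x₂ * y₂)
        ≡⟨ cong (λ e → k * (x₀ * y₀ + - (x₁ * y₁)) + e * (x₂ * y₂)) βd²≡kα ⟩
      k * (x₀ * y₀ + - (x₁ * y₁)) + k * α * (x₂ * y₂)
        ≡⟨ solve 8 (λ k α x₀ x₁ x₂ y₀ y₁ y₂ →
             k :* (x₀ :* y₀ :- x₁ :* y₁) :+ k :* α :* (x₂ :* y₂)
             := k :* (x₀ :* y₀ :- x₁ :* y₁ :+ α :* (x₂ :* y₂)))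
             refl k α x₀ x₁ x₂ y₀ y₁ y₂ ⟩
      k * form α (x₀ , x₁ , x₂) (y₀ , y₁ , y₂) ∎
      where
      k : Carrier
      k = a * a + - (b * b)

  hyperbolic-¬IsZeroVec : ∀ {a b d} → ¬ a * a + - (b * b) ≡ 0# → ¬ d ≡ 0# →
                          ∀ {x} → ¬ IsZeroVec x → ¬ IsZeroVec (hyperbolic a b d x)
  hyperbolic-¬IsZeroVec {a} {b} {d} k≢0 d≢0 {x₀ , x₁ , x₂} x≢0 (u≡0 , v≡0 , dx₂≡0) =
    x≢0 (*-cancelˡ-≡0 k≢0 (begin
           k * x₀                                             ≡⟨ eliminate a b x₀ x₁ ⟩
           a * (a * x₀ + b * x₁) + - (b * (b * x₀ + a * x₁))  ≡⟨ vanish u≡0 v≡0 ⟩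
           0#                                                 ∎) ,
         *-cancelˡ-≡0 k≢0 (begin
           k * x₁                                             ≡⟨ eliminate a b x₁ x₀ ⟩
           a * (a * x₁ + b * x₀) + - (b * (b * x₁ + a * x₀))
             ≡⟨ cong₂ (λ u v → a * u + - (b * v)) (+-comm _ _) (+-comm _ _) ⟩
           a * (b * x₀ + a * x₁) + - (b * (a * x₀ + b * x₁))  ≡⟨ vanish v≡0 u≡0 ⟩
           0#                                                 ∎) ,
         *-cancelˡ-≡0 d≢0 dx₂≡0)
    where
    k : Carrier
    k = a * a + - (b * b)
    eliminate : ∀ a b y z → (a * a + - (b * b)) * y ≡ a * (a * y + b * z) + - (b * (b * y + a * z))
    eliminate = solve 4 (λ a b y z → (a :* a :- b :* b) :* y := a :* (a :* y :+ b :* z) :- b :* (b :* y :+ a :* z)) refl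
    vanish : ∀ {u v} → u ≡ 0# → v ≡ 0# → a * u + - (b * v) ≡ 0#
    vanish refl refl = solve 2 (λ a b → a :* con (+ 0) :- b :* con (+ 0) := con (+ 0)) refl a b

  record Similitude (α β : Carrier) : Set where
    field
      transform            : Vec3 → Vec3
      multiplier           : Carrier
      multiplier≢0         : ¬ multiplier ≡ 0#
      form-transform       : ∀ x y → form β (transform x) (transform y) ≡ multiplier * form α x y
      transform-¬IsZeroVec : ∀ {x} → ¬ IsZeroVec x → ¬ IsZeroVec (transform x)

  similitude : ¬ 1# + 1# ≡ 0# → ∀ {α β} → ¬ α ≡ 0# → ¬ β ≡ 0# → Similitude α β
  similitude 2≢0 {α} {β} α≢0 β≢0 = record
    { transform            = hyperbolic a b two
    ; multiplier           = a * a + - (b * b)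
    ; multiplier≢0         = k≢0
    ; form-transform       = form-hyperbolic β·4≡kα
    ; transform-¬IsZeroVec = hyperbolic-¬IsZeroVec k≢0 2≢0
    }
    where
    two : Carrier
    two = 1# + 1#
    α⁻¹ : Carrier
    α⁻¹ = proj₁ (inverse α α≢0)
    c a b : Carrier
    c = β * α⁻¹
    a = c + 1#
    b = c + - 1#
    c≢0 : ¬ c ≡ 0#
    c≢0 = *-≢0 β≢0 (inverse-≢0 α α≢0)
    k≡4c : a * a + - (b * b) ≡ two * two * c
    k≡4c = solve 1 (λ c → (c :+ con (+ 1)) :* (c :+ con (+ 1)) :- (c :- con (+ 1)) :* (c :- con (+ 1))
                          := (con (+ 1) :+ con (+ 1)) :* (con (+ 1) :+ con (+ 1)) :* c) refl c
    k≢0 : ¬ a * a + - (b * b) ≡ 0#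
    k≢0 k≡0 = *-≢0 (*-≢0 2≢0 2≢0) c≢0 (trans (sym k≡4c) k≡0)
    cα≡β : c * α ≡ β
    cα≡β = begin
      β * α⁻¹ * α   ≡⟨ *-assoc β α⁻¹ α ⟩
      β * (α⁻¹ * α) ≡⟨ cong (β *_) (trans (*-comm α⁻¹ α) (proj₂ (inverse α α≢0))) ⟩
      β * 1#        ≡⟨ *-identityʳ β ⟩
      β             ∎
    β·4≡kα : β * (two * two) ≡ (a * a + - (b * b)) * α
    β·4≡kα = begin
      β * (two * two)        ≡⟨ *-comm β (two * two) ⟩
      two * two * β          ≡⟨ cong (two * two *_) (sym cα≡β) ⟩
      two * two * (c * α)    ≡⟨ sym (*-assoc (two * two) c α) ⟩
      two * two * c * α      ≡⟨ cong (_* α) (sym k≡4c) ⟩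
      (a * a + - (b * b)) * α ∎

  incidence-scaled : ∀ {α β K} (P R P′ R′ : Point) → ¬ K ≡ 0# →
                     form β (proj₁ P′) (proj₁ R′) ≡ K * form α (proj₁ P) (proj₁ R) →
                     incidence β P′ R′ ≡ incidence α P R
  incidence-scaled {α} {β} (p , _) (r , _) (p′ , _) (r′ , _) K≢0 form′≡Kform
    with form α p r ≟ 0# | form β p′ r′ ≟ 0#
  ... | yes _      | yes _       = refl
  ... | no  _      | no  _       = refl
  ... | yes form≡0 | no  form′≢0 = ⊥-elim (form′≢0 (trans form′≡Kform (≡0⇒*≡0 form≡0)))
  ... | no  form≢0 | yes form′≡0 = ⊥-elim (form≢0 (*-cancelˡ-≡0 K≢0 (trans (sym form′≡Kform) form′≡0)))

  incidence-cong : ∀ {α} (P R P′ R′ : Point) → proj₁ P ≡ proj₁ P′ → proj₁ R ≡ proj₁ R′ →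
                   incidence α P R ≡ incidence α P′ R′
  incidence-cong {α} P R P′ R′ p≡p′ r≡r′ = sym (incidence-scaled P R P′ R′ 1≢0
    (trans (cong₂ (form α) (sym p≡p′) (sym r≡r′)) (sym (*-identityˡ _))))

  HasKind-scaled : ∀ {α β K} i (P P′ : Point) → ¬ K ≡ 0# →
                   Q β (proj₁ P′) ≡ K * Q α (proj₁ P) → HasKind α i P → HasKind β i P′
  HasKind-scaled anisotropic P P′ K≢0 Q′≡KQ Q≢0 Q′≡0 = Q≢0 (*-cancelˡ-≡0 K≢0 (trans (sym Q′≡KQ) Q′≡0))
  HasKind-scaled isotropic   P P′ K≢0 Q′≡KQ Q≡0     = trans Q′≡KQ (≡0⇒*≡0 Q≡0)

  module _ {α β : Carrier} (S : Similitude α β) where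
    open Similitude S

    rescaling : (P : Point) → Σ Carrier λ s → ¬ s ≡ 0# × Normalized (s · transform (proj₁ P))
    rescaling (x , x-normalized) =
      normalize (transform x) (transform-¬IsZeroVec (Normalized⇒¬IsZeroVec x-normalized))

    mapPoint : Point → Point
    mapPoint P = proj₁ (rescaling P) · transform (proj₁ P) , proj₂ (proj₂ (rescaling P))

    mapPoint-scales-form : ∀ P R → Σ Carrier λ K → ¬ K ≡ 0# ×
      form β (proj₁ (mapPoint P)) (proj₁ (mapPoint R)) ≡ K * form α (proj₁ P) (proj₁ R)
    mapPoint-scales-form P R with rescaling P | rescaling R
    ... | s , s≢0 , _ | t , t≢0 , _ = s * t * multiplier , *-≢0 (*-≢0 s≢0 t≢0) multiplier≢0 , (begin
      form β (s · transform (proj₁ P)) (t · transform (proj₁ R))   ≡⟨ form-· β s t _ _ ⟩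
      s * t * form β (transform (proj₁ P)) (transform (proj₁ R))   ≡⟨ cong (s * t *_) (form-transform _ _) ⟩
      s * t * (multiplier * form α (proj₁ P) (proj₁ R))           ≡⟨ sym (*-assoc (s * t) multiplier _) ⟩
      s * t * multiplier * form α (proj₁ P) (proj₁ R)             ∎)

    incidence-mapPoint : ∀ P R → incidence β (mapPoint P) (mapPoint R) ≡ incidence α P R
    incidence-mapPoint P R = let K , K≢0 , scaled = mapPoint-scales-form P R in
      incidence-scaled P R (mapPoint P) (mapPoint R) K≢0 scaled

    mapPointOf : ∀ i → PointOf α i → PointOf β i
    mapPointOf i (P , P∈i) = let K , K≢0 , scaled = mapPoint-scales-form P P in
      mapPoint P , HasKind-scaled i P (mapPoint P) K≢0 scaled P∈i

  vectors : List Vec3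
  vectors = cartesianProduct elements (cartesianProduct elements elements)

  ∈-vectors : ∀ x → x ∈ vectors
  ∈-vectors (x₀ , x₁ , x₂) =
    ∈-cartesianProduct⁺ (complete x₀) (∈-cartesianProduct⁺ (complete x₁) (complete x₂))

  Normalized? : ∀ x → Dec (Normalized x)
  Normalized? (x₀ , x₁ , x₂) =
    x₀ ≟ 1# ⊎-dec (x₀ ≟ 0# ×-dec x₁ ≟ 1#) ⊎-dec (x₀ ≟ 0# ×-dec x₁ ≟ 0# ×-dec x₂ ≟ 1#)

  HasKind? : ∀ α i P → Dec (HasKind α i P)
  HasKind? α anisotropic (x , _) = ¬? (Q α x ≟ 0#)
  HasKind? α isotropic   (x , _) = Q α x ≟ 0#

  HasKind-irrelevant : ∀ {α} i {x} {n n′ : Normalized x} → HasKind α i (x , n) → HasKind α i (x , n′)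
  HasKind-irrelevant anisotropic h = h
  HasKind-irrelevant isotropic   h = h

  pointOf? : ∀ α i → Vec3 → Maybe (PointOf α i)
  pointOf? α i x with Normalized? x
  ... | no  _ = nothing
  ... | yes n with HasKind? α i (x , n)
  ...   | yes h = just ((x , n) , h)
  ...   | no  _ = nothing

  pointOf?-complete : ∀ α i (p : PointOf α i) →
    Maybe.Any (λ p′ → proj₁ (proj₁ p′) ≡ proj₁ (proj₁ p)) (pointOf? α i (proj₁ (proj₁ p)))
  pointOf?-complete α i ((x , n) , h) with Normalized? x
  ... | no ¬n = ⊥-elim (¬n n)
  ... | yes n′ with HasKind? α i (x , n′)
  ...   | yes _  = Maybe.just refl
  ...   | no  ¬h = ⊥-elim (¬h (HasKind-irrelevant i h))

  points : ∀ α i → List (PointOf α i)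
  points α i = mapMaybe (pointOf? α i) vectors

  points-complete : ∀ α i (p : PointOf α i) →
                    Any (λ p′ → proj₁ (proj₁ p′) ≡ proj₁ (proj₁ p)) (points α i)
  points-complete α i p = mapMaybe⁺ (pointOf? α i) vectors
    (map⁺ (Any.map (λ { refl → pointOf?-complete α i p }) (∈-vectors (proj₁ (proj₁ p)))))

  Has2Rank-block-similar : ∀ {α β r} i j → Similitude α β → Similitude β α →
                           Has2Rank (block α i j) r → Has2Rank (block β i j) r
  Has2Rank-block-similar {α} {β} i j S S′ =
    Has2Rank-transport (block α i j) (block β i j)
      (mapPointOf S i) (mapPointOf S j) (mapPointOf S′ i) (mapPointOf S′ j)
      (λ P R → incidence-mapPoint S (proj₁ P) (proj₁ R))
      (λ P R → incidence-mapPoint S′ (proj₁ P) (proj₁ R))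

  block-has2Rank : ∀ α i j → Σ ℕ (Has2Rank (block α i j))
  block-has2Rank α i j = has2Rank-coveredBy (block α i j) (points α i) (points α j)
    (λ P → Any.map (λ {P′} same R → incidence-cong (proj₁ P′) (proj₁ R) (proj₁ P) (proj₁ R) same refl)
                   (points-complete α i P))
    (λ R → Any.map (λ {R′} same P → incidence-cong (proj₁ P) (proj₁ R′) (proj₁ P) (proj₁ R) refl same)
                   (points-complete α j R))

lemma3p1 : (F : FiniteField) →
    ¬ (FiniteField._+_ F (FiniteField.1# F) (FiniteField.1# F) ≡ FiniteField.0# F) →
    (α β : FiniteField.Carrier F) →
    ¬ (α ≡ FiniteField.0# F) → ¬ (β ≡ FiniteField.0# F) →
    (i j : Plane.Kind F) →
    Σ ℕ (λ r → Has2Rank (Plane.block F α i j) r × Has2Rank (Plane.block F β i j) r)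
lemma3p1 F 2≢0 α β α≢0 β≢0 i j =
  let r , rank = block-has2Rank α i j in
  r , rank , Has2Rank-block-similar i j (similitude 2≢0 α≢0 β≢0) (similitude 2≢0 β≢0 α≢0) rank
  where open ProjectivePlane F
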